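{- For an integer $n\ge 0$, let $F(n)$ denote the number of zero-one matrices (of any size) having exactly $n$ entries equal to $1$ and no row or column consisting entirely of zeros, with the convention $F(0)=1$. Then \[ F(n)=\sum_{k=0}^\infty\sum_{l=0}^\infty \frac{1}{2^{k+l+2}}\binom{kl}{n}. \]
   Context: Matrices are counted as arrays: the order of rows and columns matters, and repeated rows or columns are allowed. The binomial coefficient $\binom{m}{n}$ is $0$ when $m<n$. -}

module Defs where

open import Data.Bool using (Bool; true; false; _∧_; _∨_)
open import Data.Nat using (ℕ; zero; suc; _+_; _*_; _≟_)
open import Data.Nat.Combinatorics using (_C_)
open import Data.Integer using (+_)
open import Data.Vec using (Vec; []; _∷_; foldr; map; replicate; zipWith)
open import Data.Product using (Σ; _×_; ∃; _,_)
open import Data.Fin using (Fin)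
open import Data.Rational as ℚ using (ℚ; 0ℚ; 1ℚ; ½; _<_; _≤_; _-_)
open import Relation.Nullary.Decidable using (⌊_⌋)
open import Relation.Binary.PropositionalEquality using (_≡_)
open import Function.Bundles using (_↔_)

Matrix01 : ℕ → ℕ → Set
Matrix01 m p = Vec (Vec Bool p) m

onesRow : ∀ {p} → Vec Bool p → ℕ
onesRow [] = 0
onesRow (true ∷ r) = suc (onesRow r)
onesRow (false ∷ r) = onesRow r

ones : ∀ {m p} → Matrix01 m p → ℕ
ones [] = 0
ones (r ∷ rs) = onesRow r + ones rs

anyV : ∀ {p} → Vec Bool p → Bool
anyV = foldr _ _∨_ false

allV : ∀ {p} → Vec Bool p → Bool
allV = foldr _ _∧_ true

noZeroRow : ∀ {m p} → Matrix01 m p → Bool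
noZeroRow rs = allV (map anyV rs)

noZeroCol : ∀ {m p} → Matrix01 m p → Bool
noZeroCol {p = p} rs = allV (foldr _ (zipWith _∨_) (replicate p false) rs)

Valid : ℕ → ∀ {m p} → Matrix01 m p → Bool
Valid n M = ⌊ ones M ≟ n ⌋ ∧ noZeroRow M ∧ noZeroCol M

Counted : ℕ → Set
Counted n = Σ ℕ λ m → Σ ℕ λ p → Σ (Matrix01 m p) λ M → Valid n M ≡ true

halfPow : ℕ → ℚ
halfPow zero = 1ℚ
halfPow (suc k) = ½ ℚ.* halfPow k

term : ℕ → ℕ → ℕ → ℚ
term n k l = ((+ ((k * l) C n)) ℚ./ 1) ℚ.* halfPow (k + l + 2)

sumTo : ℕ → (ℕ → ℚ) → ℚ
sumTo zero f = 0ℚ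
sumTo (suc N) f = sumTo N f ℚ.+ f N

partial : ℕ → ℕ → ℚ
partial n N = sumTo N λ k → sumTo N λ l → term n k l

-- the double series of nonnegative terms sums to c:
-- c is the supremum of the (increasing) square partial sums
SumsTo : (ℕ → ℕ → ℚ) → ℚ → Set
SumsTo f c = (∀ N → (sumTo N λ k → sumTo N λ l → f k l) ≤ c)
           × (∀ ε → 0ℚ < ε → ∃ λ N → c - ε < (sumTo N λ k → sumTo N λ l → f k l))

{-# OPTIONS --safe #-}
module Submission where

-- Write B(i, j) for the number of valid i × j matrices with n ones; they vanish unless i, j ≤ n,
-- and F(n) = Σ_{i,j ≤ n} B(i, j). A k × l matrix with n ones is determined by its sets of nonzero
-- rows and columns together with the valid matrix they carry, so C(kl, n) = Σ C(k,i) C(l,j) B(i, j).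
-- Summing against 2^-(k+1) 2^-(l+1), the N-th square partial sum becomes Σ B(i, j) S_N(i) S_N(j)
-- with S_N(i) = Σ_{k<N} C(k,i) / 2^(k+1) = 1 - R_N(i), R_N(i) = Σ_{j ≤ i} C(N,j) / 2^N.
-- Hence it lies between F(n) - 2 F(n) R_N(n) and F(n), and R_N(n) → 0 at rate 1/N because
-- (N+1) C(N,j) = (j+1) C(N+1,j+1) ≤ (j+1) 2^(N+1).

open import Algebra.Bundles using (CommutativeSemiring)

module RangeSum {c ℓ} (R : CommutativeSemiring c ℓ) where

  open import Data.Nat.Base using (ℕ; zero; suc; z≤n; s≤s) renaming (_+_ to _+ℕ_; _≤_ to _≤ℕ_)
  import Data.Nat.Properties as ℕP
  open import Relation.Binary.PropositionalEquality using (cong)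
  open CommutativeSemiring R
  open import Algebra.Properties.CommutativeSemigroup +-commutativeSemigroup using (interchange)
  open import Relation.Binary.Reasoning.Setoid setoid

  ∑ : ℕ → (ℕ → Carrier) → Carrier
  ∑ zero    f = 0#
  ∑ (suc N) f = f 0 + ∑ N (λ i → f (suc i))

  ∑-cong : ∀ N {f g : ℕ → Carrier} → (∀ i → f i ≈ g i) → ∑ N f ≈ ∑ N g
  ∑-cong zero    f≈g = refl
  ∑-cong (suc N) f≈g = +-cong (f≈g 0) (∑-cong N (λ i → f≈g (suc i)))

  ∑-zero : ∀ N {f : ℕ → Carrier} → (∀ i → f i ≈ 0#) → ∑ N f ≈ 0#
  ∑-zero zero    f≈0 = refl
  ∑-zero (suc N) f≈0 = trans (+-cong (f≈0 0) (∑-zero N (λ i → f≈0 (suc i)))) (+-identityˡ 0#)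

  ∑-distrib-+ : ∀ N (f g : ℕ → Carrier) → ∑ N (λ i → f i + g i) ≈ ∑ N f + ∑ N g
  ∑-distrib-+ zero    f g = sym (+-identityˡ 0#)
  ∑-distrib-+ (suc N) f g =
    trans (+-congˡ (∑-distrib-+ N (λ i → f (suc i)) (λ i → g (suc i)))) (interchange _ _ _ _)

  *-distribˡ-∑ : ∀ N x (f : ℕ → Carrier) → x * ∑ N f ≈ ∑ N (λ i → x * f i)
  *-distribˡ-∑ zero    x f = zeroʳ x
  *-distribˡ-∑ (suc N) x f = trans (distribˡ x _ _) (+-congˡ (*-distribˡ-∑ N x (λ i → f (suc i))))

  *-distribʳ-∑ : ∀ N x (f : ℕ → Carrier) → ∑ N f * x ≈ ∑ N (λ i → f i * x)
  *-distribʳ-∑ N x f = trans (*-comm _ x) (trans (*-distribˡ-∑ N x f) (∑-cong N (λ i → *-comm x (f i))))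

  ∑-comm : ∀ M N (f : ℕ → ℕ → Carrier) → ∑ M (λ i → ∑ N (f i)) ≈ ∑ N (λ j → ∑ M (λ i → f i j))
  ∑-comm zero    N f = sym (∑-zero N (λ _ → refl))
  ∑-comm (suc M) N f = begin
    ∑ N (f 0) + ∑ M (λ i → ∑ N (f (suc i)))      ≈⟨ +-congˡ (∑-comm M N (λ i → f (suc i))) ⟩
    ∑ N (f 0) + ∑ N (λ j → ∑ M (λ i → f (suc i) j)) ≈⟨ ∑-distrib-+ N (f 0) _ ⟨
    ∑ N (λ j → ∑ (suc M) (λ i → f i j))           ∎

  ∑-*-∑ : ∀ M N (f g : ℕ → Carrier) → ∑ M f * ∑ N g ≈ ∑ M (λ i → ∑ N (λ j → f i * g j))
  ∑-*-∑ M N f g = trans (*-distribʳ-∑ M (∑ N g) f) (∑-cong M (λ i → *-distribˡ-∑ N (f i) g))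

  ∑∑-comm : ∀ M N (f : ℕ → ℕ → ℕ → ℕ → Carrier) →
            ∑ M (λ k → ∑ M (λ l → ∑ N (λ i → ∑ N (f k l i)))) ≈
            ∑ N (λ i → ∑ N (λ j → ∑ M (λ k → ∑ M (λ l → f k l i j))))
  ∑∑-comm M N f = begin
    ∑ M (λ k → ∑ M (λ l → ∑ N (λ i → ∑ N (f k l i))))
      ≈⟨ ∑-cong M (λ k → ∑-comm M N (λ l i → ∑ N (f k l i))) ⟩
    ∑ M (λ k → ∑ N (λ i → ∑ M (λ l → ∑ N (f k l i))))
      ≈⟨ ∑-comm M N (λ k i → ∑ M (λ l → ∑ N (f k l i))) ⟩
    ∑ N (λ i → ∑ M (λ k → ∑ M (λ l → ∑ N (f k l i))))
      ≈⟨ ∑-cong N (λ i → ∑-cong M (λ k → ∑-comm M N (λ l → f k l i))) ⟩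
    ∑ N (λ i → ∑ M (λ k → ∑ N (λ j → ∑ M (λ l → f k l i j))))
      ≈⟨ ∑-cong N (λ i → ∑-comm M N (λ k j → ∑ M (λ l → f k l i j))) ⟩
    ∑ N (λ i → ∑ N (λ j → ∑ M (λ k → ∑ M (λ l → f k l i j))))
      ∎

  ∑-last : ∀ N (f : ℕ → Carrier) → ∑ (suc N) f ≈ ∑ N f + f N
  ∑-last zero    f = trans (+-identityʳ (f 0)) (sym (+-identityˡ (f 0)))
  ∑-last (suc N) f = trans (+-congˡ (∑-last N (λ i → f (suc i)))) (sym (+-assoc _ _ _))

  ∑-trim : ∀ M K {f : ℕ → Carrier} → (∀ i → M ≤ℕ i → f i ≈ 0#) → ∑ (M +ℕ K) f ≈ ∑ M f
  ∑-trim zero    K f≈0 = ∑-zero K (λ i → f≈0 i z≤n)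
  ∑-trim (suc M) K f≈0 = +-congˡ (∑-trim M K (λ i M≤i → f≈0 (suc i) (s≤s M≤i)))

  ∑-resize : ∀ M N {f : ℕ → Carrier} → (∀ i → M ≤ℕ i → f i ≈ 0#) → (∀ i → N ≤ℕ i → f i ≈ 0#) →
             ∑ M f ≈ ∑ N f
  ∑-resize M N {f} f≈0₁ f≈0₂ = begin
    ∑ M f        ≈⟨ ∑-trim M N f≈0₁ ⟨
    ∑ (M +ℕ N) f ≡⟨ cong (λ L → ∑ L f) (ℕP.+-comm M N) ⟩
    ∑ (N +ℕ M) f ≈⟨ ∑-trim N M f≈0₂ ⟩
    ∑ N f        ∎

module Matrices where

  open import Defs
  open import Data.Bool using (Bool; true; false; _∧_; _∨_; if_then_else_)
  open import Data.Bool.Properties using (∨-identityˡ; ∧-identityʳ; ∧-zeroʳ; ∧-assoc)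
  open import Data.Nat using (ℕ; zero; suc; _+_; _*_; _≤_; _<_; _≟_; z≤n; s≤s)
  open import Data.Nat.Properties
  open import Data.Nat.Combinatorics using (_C_; nCk+nC[k+1]≡[n+1]C[k+1]; k>n⇒nCk≡0)
  open import Data.Vec using (Vec; []; _∷_; _++_; map; replicate; zipWith; foldr; transpose)
  open import Data.Vec.Properties using (zipWith-is-⊛; zipWith-identityˡ)
  open import Data.Product using (_×_; _,_; proj₁; proj₂)
  open import Relation.Binary.PropositionalEquality
  open import Relation.Nullary.Decidable using (⌊_⌋; yes; no)
  open import Relation.Nullary.Negation using (¬_; contradiction)
  open import Function using (_∘_)
  open import Algebra.Properties.CommutativeSemigroup +-commutativeSemigroup using (interchange; x∙yz≈y∙xz)
  open RangeSum +-*-commutativeSemiring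
  open ≡-Reasoning

  indicator : Bool → ℕ
  indicator true  = 1
  indicator false = 0

  ∑Vec : ∀ l → (Vec Bool l → ℕ) → ℕ
  ∑Vec zero    g = g []
  ∑Vec (suc l) g = ∑Vec l (λ v → g (false ∷ v)) + ∑Vec l (λ v → g (true ∷ v))

  ∑Vec-cong : ∀ l {g h : Vec Bool l → ℕ} → (∀ v → g v ≡ h v) → ∑Vec l g ≡ ∑Vec l h
  ∑Vec-cong zero    g≡h = g≡h []
  ∑Vec-cong (suc l) g≡h =
    cong₂ _+_ (∑Vec-cong l (λ v → g≡h (false ∷ v))) (∑Vec-cong l (λ v → g≡h (true ∷ v)))

  ∑Vec-zero : ∀ l {g : Vec Bool l → ℕ} → (∀ v → g v ≡ 0) → ∑Vec l g ≡ 0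
  ∑Vec-zero zero    g≡0 = g≡0 []
  ∑Vec-zero (suc l) g≡0 =
    cong₂ _+_ (∑Vec-zero l (λ v → g≡0 (false ∷ v))) (∑Vec-zero l (λ v → g≡0 (true ∷ v)))

  ∑Vec-distrib-+ : ∀ l (g h : Vec Bool l → ℕ) → ∑Vec l (λ v → g v + h v) ≡ ∑Vec l g + ∑Vec l h
  ∑Vec-distrib-+ zero    g h = refl
  ∑Vec-distrib-+ (suc l) g h = trans
    (cong₂ _+_ (∑Vec-distrib-+ l (λ v → g (false ∷ v)) (λ v → h (false ∷ v)))
               (∑Vec-distrib-+ l (λ v → g (true ∷ v)) (λ v → h (true ∷ v))))
    (interchange (∑Vec l (λ v → g (false ∷ v))) (∑Vec l (λ v → h (false ∷ v))) _ _)

  *-distribˡ-∑Vec : ∀ l c (g : Vec Bool l → ℕ) → c * ∑Vec l g ≡ ∑Vec l (λ v → c * g v)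
  *-distribˡ-∑Vec zero    c g = refl
  *-distribˡ-∑Vec (suc l) c g =
    trans (*-distribˡ-+ c _ _) (cong₂ _+_ (*-distribˡ-∑Vec l c _) (*-distribˡ-∑Vec l c _))

  ∑Vec-comm : ∀ a b (h : Vec Bool a → Vec Bool b → ℕ) →
              ∑Vec a (λ x → ∑Vec b (h x)) ≡ ∑Vec b (λ y → ∑Vec a (λ x → h x y))
  ∑Vec-comm zero    b h = refl
  ∑Vec-comm (suc a) b h = begin
    ∑Vec a (λ x → ∑Vec b (h (false ∷ x))) + ∑Vec a (λ x → ∑Vec b (h (true ∷ x)))
      ≡⟨ cong₂ _+_ (∑Vec-comm a b (λ x → h (false ∷ x))) (∑Vec-comm a b (λ x → h (true ∷ x))) ⟩
    ∑Vec b (λ y → ∑Vec a (λ x → h (false ∷ x) y)) + ∑Vec b (λ y → ∑Vec a (λ x → h (true ∷ x) y))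
      ≡⟨ ∑Vec-distrib-+ b _ _ ⟨
    ∑Vec b (λ y → ∑Vec (suc a) (λ x → h x y))
      ∎

  ∑Vec-∑ : ∀ l N (f : Vec Bool l → ℕ → ℕ) →
           ∑Vec l (λ v → ∑ N (f v)) ≡ ∑ N (λ i → ∑Vec l (λ v → f v i))
  ∑Vec-∑ l zero    f = ∑Vec-zero l (λ _ → refl)
  ∑Vec-∑ l (suc N) f =
    trans (∑Vec-distrib-+ l _ _) (cong (∑Vec l (λ v → f v 0) +_) (∑Vec-∑ l N (λ v i → f v (suc i))))

  ∑Vec-++ : ∀ a b (h : Vec Bool (a + b) → ℕ) →
            ∑Vec (a + b) h ≡ ∑Vec a (λ x → ∑Vec b (λ y → h (x ++ y)))
  ∑Vec-++ zero    b h = refl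
  ∑Vec-++ (suc a) b h = cong₂ _+_ (∑Vec-++ a b _) (∑Vec-++ a b _)

  ∑Vec-split-zeros : ∀ l (h : Vec Bool l → ℕ) →
                     ∑Vec l h ≡ h (replicate l false) + ∑Vec l (λ v → if anyV v then h v else 0)
  ∑Vec-split-zeros zero    h = sym (+-identityʳ _)
  ∑Vec-split-zeros (suc l) h =
    trans (cong (_+ ∑Vec l (λ v → h (true ∷ v))) (∑Vec-split-zeros l (λ v → h (false ∷ v))))
          (+-assoc (h (false ∷ replicate l false)) _ _)

  ∑Mat : ∀ k l → (Matrix01 k l → ℕ) → ℕ
  ∑Mat zero    l f = f []
  ∑Mat (suc k) l f = ∑Vec l (λ r → ∑Mat k l (λ M → f (r ∷ M)))

  ∑Mat-cong : ∀ k l {f g : Matrix01 k l → ℕ} → (∀ M → f M ≡ g M) → ∑Mat k l f ≡ ∑Mat k l g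
  ∑Mat-cong zero    l f≡g = f≡g []
  ∑Mat-cong (suc k) l f≡g = ∑Vec-cong l (λ r → ∑Mat-cong k l (λ M → f≡g (r ∷ M)))

  ∑Mat-zero : ∀ k l {f : Matrix01 k l → ℕ} → (∀ M → f M ≡ 0) → ∑Mat k l f ≡ 0
  ∑Mat-zero zero    l f≡0 = f≡0 []
  ∑Mat-zero (suc k) l f≡0 = ∑Vec-zero l (λ r → ∑Mat-zero k l (λ M → f≡0 (r ∷ M)))

  ∑Mat-no-columns : ∀ k (f : Matrix01 k 0 → ℕ) → ∑Mat k 0 f ≡ f (replicate k [])
  ∑Mat-no-columns zero    f = refl
  ∑Mat-no-columns (suc k) f = ∑Mat-no-columns k (λ M → f ([] ∷ M))

  ∑Mat-first-column : ∀ k l (f : Matrix01 k (suc l) → ℕ) →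
                      ∑Mat k (suc l) f ≡ ∑Vec k (λ c → ∑Mat k l (λ M → f (zipWith _∷_ c M)))
  ∑Mat-first-column zero    l f = refl
  ∑Mat-first-column (suc k) l f = trans
    (∑Vec-cong (suc l) (λ r → ∑Mat-first-column k l (λ M → f (r ∷ M))))
    (cong₂ _+_ (∑Vec-comm l k _) (∑Vec-comm l k _))

  transpose-∷ : ∀ {A : Set} {k l} (c : Vec A k) (M : Vec (Vec A k) l) →
                transpose (c ∷ M) ≡ zipWith _∷_ c (transpose M)
  transpose-∷ c M = sym (zipWith-is-⊛ _∷_ c (transpose M))

  ∑Mat-transpose : ∀ k l (f : Matrix01 k l → ℕ) → ∑Mat k l f ≡ ∑Mat l k (λ M → f (transpose M))
  ∑Mat-transpose k zero    f = ∑Mat-no-columns k f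
  ∑Mat-transpose k (suc l) f = trans (∑Mat-first-column k l f) (∑Vec-cong k (λ c → begin
    ∑Mat k l (λ M → f (zipWith _∷_ c M))             ≡⟨ ∑Mat-transpose k l _ ⟩
    ∑Mat l k (λ M → f (zipWith _∷_ c (transpose M))) ≡⟨ ∑Mat-cong l k (λ M → cong f (transpose-∷ c M)) ⟨
    ∑Mat l k (λ M → f (transpose (c ∷ M)))           ∎))

  ⌊suc≟suc⌋ : ∀ m n → ⌊ suc m ≟ suc n ⌋ ≡ ⌊ m ≟ n ⌋
  ⌊suc≟suc⌋ m n with m ≟ n | suc m ≟ suc n
  ... | yes _   | yes _     = refl
  ... | no  _   | no  _     = refl
  ... | yes m≡n | no  m+1≢n+1 = contradiction (cong suc m≡n) m+1≢n+1
  ... | no  m≢n | yes m+1≡n+1 = contradiction (suc-injective m+1≡n+1) m≢n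

  ∑Vec-onesRow≡C : ∀ N n → ∑Vec N (λ v → indicator ⌊ onesRow v ≟ n ⌋) ≡ N C n
  ∑Vec-onesRow≡C zero    zero    = refl
  ∑Vec-onesRow≡C zero    (suc n) = refl
  ∑Vec-onesRow≡C (suc N) zero    = cong₂ _+_ (∑Vec-onesRow≡C N zero) (∑Vec-zero N (λ _ → refl))
  ∑Vec-onesRow≡C (suc N) (suc n) = begin
    ∑Vec N (λ v → indicator ⌊ onesRow v ≟ suc n ⌋) + ∑Vec N (λ v → indicator ⌊ suc (onesRow v) ≟ suc n ⌋)
      ≡⟨ cong₂ _+_ (∑Vec-onesRow≡C N (suc n))
                   (trans (∑Vec-cong N (λ v → cong indicator (⌊suc≟suc⌋ (onesRow v) n))) (∑Vec-onesRow≡C N n)) ⟩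
    N C suc n + N C n ≡⟨ +-comm (N C suc n) (N C n) ⟩
    N C n + N C suc n ≡⟨ nCk+nC[k+1]≡[n+1]C[k+1] N n ⟩
    suc N C suc n     ∎

  onesRow-++ : ∀ {a b} (x : Vec Bool a) (y : Vec Bool b) → onesRow (x ++ y) ≡ onesRow x + onesRow y
  onesRow-++ []          y = refl
  onesRow-++ (true ∷ x)  y = cong suc (onesRow-++ x y)
  onesRow-++ (false ∷ x) y = onesRow-++ x y

  ∑Mat-ones : ∀ k l (g : ℕ → ℕ) → ∑Mat k l (λ M → g (ones M)) ≡ ∑Vec (k * l) (λ v → g (onesRow v))
  ∑Mat-ones zero    l g = refl
  ∑Mat-ones (suc k) l g = begin
    ∑Vec l (λ r → ∑Mat k l (λ M → g (onesRow r + ones M)))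
      ≡⟨ ∑Vec-cong l (λ r → ∑Mat-ones k l (λ x → g (onesRow r + x))) ⟩
    ∑Vec l (λ r → ∑Vec (k * l) (λ v → g (onesRow r + onesRow v)))
      ≡⟨ ∑Vec-cong l (λ r → ∑Vec-cong (k * l) (λ v → cong g (onesRow-++ r v))) ⟨
    ∑Vec l (λ r → ∑Vec (k * l) (λ v → g (onesRow (r ++ v))))
      ≡⟨ ∑Vec-++ l (k * l) (λ w → g (onesRow w)) ⟨
    ∑Vec (l + k * l) (λ w → g (onesRow w))
      ∎

  ∑Mat-ones≡C : ∀ k l n → ∑Mat k l (λ M → indicator ⌊ ones M ≟ n ⌋) ≡ (k * l) C n
  ∑Mat-ones≡C k l n = trans (∑Mat-ones k l (λ x → indicator ⌊ x ≟ n ⌋)) (∑Vec-onesRow≡C (k * l) n)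

  ∑-pascal : ∀ k (a : ℕ → ℕ) →
             ∑ (suc k) (λ i → (k C i) * (a i + a (suc i))) ≡ ∑ (suc (suc k)) (λ i → (suc k C i) * a i)
  ∑-pascal k a = begin
    ∑ (suc k) (λ i → (k C i) * (a i + a (suc i)))
      ≡⟨ ∑-cong (suc k) (λ i → *-distribˡ-+ (k C i) (a i) (a (suc i))) ⟩
    ∑ (suc k) (λ i → (k C i) * a i + (k C i) * a (suc i))
      ≡⟨ ∑-distrib-+ (suc k) (λ i → (k C i) * a i) (λ i → (k C i) * a (suc i)) ⟩
    (a₀ + X) + Y  ≡⟨ +-assoc a₀ X Y ⟩
    a₀ + (X + Y)  ≡⟨ cong (a₀ +_) (+-comm X Y) ⟩
    a₀ + (Y + X)  ≡⟨ cong (λ Z → a₀ + (Y + Z)) X≡X⁺ ⟩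
    a₀ + (Y + X⁺) ≡⟨ cong (a₀ +_) (∑-distrib-+ (suc k) (λ i → (k C i) * a (suc i))
                                                       (λ i → (k C suc i) * a (suc i))) ⟨
    a₀ + ∑ (suc k) (λ i → (k C i) * a (suc i) + (k C suc i) * a (suc i))
      ≡⟨ cong (a₀ +_) (∑-cong (suc k) (λ i → pascal-term i)) ⟩
    ∑ (suc (suc k)) (λ i → (suc k C i) * a i)
      ∎
    where
    a₀ = 1 * a 0
    X  = ∑ k (λ i → (k C suc i) * a (suc i))
    X⁺ = ∑ (suc k) (λ i → (k C suc i) * a (suc i))
    Y  = ∑ (suc k) (λ i → (k C i) * a (suc i))
    X≡X⁺ : X ≡ X⁺
    X≡X⁺ = sym (begin
      X⁺                          ≡⟨ ∑-last k (λ i → (k C suc i) * a (suc i)) ⟩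
      X + (k C suc k) * a (suc k) ≡⟨ cong (λ c → X + c * a (suc k)) (k>n⇒nCk≡0 (n<1+n k)) ⟩
      X + 0                       ≡⟨ +-identityʳ X ⟩
      X                           ∎)
    pascal-term : ∀ i → (k C i) * a (suc i) + (k C suc i) * a (suc i) ≡ (suc k C suc i) * a (suc i)
    pascal-term i = trans (sym (*-distribʳ-+ (a (suc i)) (k C i) _))
                          (cong (_* a (suc i)) (nCk+nC[k+1]≡[n+1]C[k+1] k i))

  -- A k-row matrix is an i-row matrix without zero rows into which k - i zero rows have been
  -- inserted, in one of k C i ways; a state on which zero rows act trivially does not see them.
  module DeleteZeroRows {L : ℕ} {S : Set} (_▷_ : Vec Bool L → S → S)
                        (zeros-▷ : ∀ s → replicate L false ▷ s ≡ s)
                        (state : ∀ {k} → Matrix01 k L → S)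
                        (state-∷ : ∀ {k} r (M : Matrix01 k L) → state (r ∷ M) ≡ r ▷ state M) where

    count : ℕ → (S → Bool) → ℕ
    count k P = ∑Mat k L (λ M → indicator (P (state M)))

    countNoZeroRow : ℕ → (S → Bool) → ℕ
    countNoZeroRow k P = ∑Mat k L (λ M → indicator (P (state M) ∧ noZeroRow M))

    count-∷ : ∀ k P → count (suc k) P ≡ ∑Vec L (λ r → count k (P ∘ (r ▷_)))
    count-∷ k P = ∑Vec-cong L (λ r → ∑Mat-cong k L (λ M → cong (indicator ∘ P) (state-∷ r M)))

    countNoZeroRow-∷ : ∀ i P → ∑Vec L (λ r → countNoZeroRow i (P ∘ (r ▷_)))
                               ≡ countNoZeroRow i P + countNoZeroRow (suc i) P
    countNoZeroRow-∷ i P = trans (∑Vec-split-zeros L _) (cong₂ _+_ zero-row (sym (∑Vec-cong L nonzero-row)))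
      where
      zero-row : countNoZeroRow i (P ∘ (replicate L false ▷_)) ≡ countNoZeroRow i P
      zero-row = ∑Mat-cong i L (λ M → cong (λ s → indicator (P s ∧ noZeroRow M)) (zeros-▷ (state M)))
      guarded : ∀ b Q → ∑Mat i L (λ M → indicator (Q (state M) ∧ (b ∧ noZeroRow M)))
                        ≡ (if b then countNoZeroRow i Q else 0)
      guarded true  Q = refl
      guarded false Q = ∑Mat-zero i L (λ M → cong indicator (∧-zeroʳ (Q (state M))))
      nonzero-row : ∀ r → ∑Mat i L (λ M → indicator (P (state (r ∷ M)) ∧ noZeroRow (r ∷ M)))
                          ≡ (if anyV r then countNoZeroRow i (P ∘ (r ▷_)) else 0)
      nonzero-row r = trans
        (∑Mat-cong i L (λ M → cong (λ s → indicator (P s ∧ noZeroRow (r ∷ M))) (state-∷ r M)))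
        (guarded (anyV r) (P ∘ (r ▷_)))

    count≡∑C*countNoZeroRow : ∀ k P → count k P ≡ ∑ (suc k) (λ i → (k C i) * countNoZeroRow i P)
    count≡∑C*countNoZeroRow zero    P =
      sym (trans (+-identityʳ _) (trans (*-identityˡ _) (cong indicator (∧-identityʳ (P (state []))))))
    count≡∑C*countNoZeroRow (suc k) P = begin
      count (suc k) P
        ≡⟨ count-∷ k P ⟩
      ∑Vec L (λ r → count k (P ∘ (r ▷_)))
        ≡⟨ ∑Vec-cong L (λ r → count≡∑C*countNoZeroRow k (P ∘ (r ▷_))) ⟩
      ∑Vec L (λ r → ∑ (suc k) (λ i → (k C i) * countNoZeroRow i (P ∘ (r ▷_))))
        ≡⟨ ∑Vec-∑ L (suc k) (λ r i → (k C i) * countNoZeroRow i (P ∘ (r ▷_))) ⟩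
      ∑ (suc k) (λ i → ∑Vec L (λ r → (k C i) * countNoZeroRow i (P ∘ (r ▷_))))
        ≡⟨ ∑-cong (suc k) (λ i → sym (*-distribˡ-∑Vec L (k C i) (λ r → countNoZeroRow i (P ∘ (r ▷_))))) ⟩
      ∑ (suc k) (λ i → (k C i) * ∑Vec L (λ r → countNoZeroRow i (P ∘ (r ▷_))))
        ≡⟨ ∑-cong (suc k) (λ i → cong ((k C i) *_) (countNoZeroRow-∷ i P)) ⟩
      ∑ (suc k) (λ i → (k C i) * (countNoZeroRow i P + countNoZeroRow (suc i) P))
        ≡⟨ ∑-pascal k (λ i → countNoZeroRow i P) ⟩
      ∑ (suc (suc k)) (λ i → (suc k C i) * countNoZeroRow i P)
        ∎

  onesRow-replicate-false : ∀ l → onesRow (replicate l false) ≡ 0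
  onesRow-replicate-false zero    = refl
  onesRow-replicate-false (suc l) = onesRow-replicate-false l

  module ByRows (l : ℕ) = DeleteZeroRows {l} (λ r c → onesRow r + c)
    (λ c → cong (_+ c) (onesRow-replicate-false l)) ones (λ r M → refl)

  anyPerColumn : ∀ {m p} → Matrix01 m p → Vec Bool p
  anyPerColumn {p = p} = foldr _ (zipWith _∨_) (replicate p false)

  anyPerColumn-zipWith-∷ : ∀ {m p} (c : Vec Bool m) (M : Matrix01 m p) →
                           anyPerColumn (zipWith _∷_ c M) ≡ anyV c ∷ anyPerColumn M
  anyPerColumn-zipWith-∷ []      []      = refl
  anyPerColumn-zipWith-∷ (b ∷ c) (r ∷ M) = cong (zipWith _∨_ (b ∷ r)) (anyPerColumn-zipWith-∷ c M)

  noZeroCol-transpose : ∀ {m p} (M : Matrix01 m p) → noZeroCol (transpose M) ≡ noZeroRow M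
  noZeroCol-transpose {p = p} [] = cong allV (no-columns (anyPerColumn (replicate p [])))
    where
    no-columns : (v : Vec Bool 0) → v ≡ []
    no-columns [] = refl
  noZeroCol-transpose (r ∷ M) = begin
    allV (anyPerColumn (transpose (r ∷ M)))         ≡⟨ cong (allV ∘ anyPerColumn) (transpose-∷ r M) ⟩
    allV (anyPerColumn (zipWith _∷_ r (transpose M))) ≡⟨ cong allV (anyPerColumn-zipWith-∷ r (transpose M)) ⟩
    anyV r ∧ noZeroCol (transpose M)                  ≡⟨ cong (anyV r ∧_) (noZeroCol-transpose M) ⟩
    anyV r ∧ noZeroRow M                              ∎

  map-anyV-zipWith-∷ : ∀ {m p} (c : Vec Bool m) (M : Matrix01 m p) →
                       map anyV (zipWith _∷_ c M) ≡ zipWith _∨_ c (map anyV M)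
  map-anyV-zipWith-∷ []      []      = refl
  map-anyV-zipWith-∷ (b ∷ c) (r ∷ M) = cong ((b ∨ anyV r) ∷_) (map-anyV-zipWith-∷ c M)

  ones-zipWith-∷ : ∀ {m p} (c : Vec Bool m) (M : Matrix01 m p) → ones (zipWith _∷_ c M) ≡ onesRow c + ones M
  ones-zipWith-∷ []          []      = refl
  ones-zipWith-∷ (true ∷ c)  (r ∷ M) =
    cong suc (trans (cong (onesRow r +_) (ones-zipWith-∷ c M)) (x∙yz≈y∙xz (onesRow r) (onesRow c) (ones M)))
  ones-zipWith-∷ (false ∷ c) (r ∷ M) =
    trans (cong (onesRow r +_) (ones-zipWith-∷ c M)) (x∙yz≈y∙xz (onesRow r) (onesRow c) (ones M))

  -- C lists the columns of transpose C; the state records its nonzero rows and number of ones.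
  columnState : ∀ {i l} → Matrix01 l i → Vec Bool i × ℕ
  columnState C = map anyV (transpose C) , ones (transpose C)

  addColumn : ∀ {i} → Vec Bool i → Vec Bool i × ℕ → Vec Bool i × ℕ
  addColumn c (u , x) = zipWith _∨_ c u , onesRow c + x

  columnState-∷ : ∀ {i l} (c : Vec Bool i) (C : Matrix01 l i) →
                  columnState (c ∷ C) ≡ addColumn c (columnState C)
  columnState-∷ c C rewrite transpose-∷ c C =
    cong₂ _,_ (map-anyV-zipWith-∷ c (transpose C)) (ones-zipWith-∷ c (transpose C))

  addColumn-zeros : ∀ {i} (s : Vec Bool i × ℕ) → addColumn (replicate i false) s ≡ s
  addColumn-zeros {i} (u , x) =
    cong₂ _,_ (zipWith-identityˡ ∨-identityˡ u) (cong (_+ x) (onesRow-replicate-false i))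

  module ByColumns (i : ℕ) = DeleteZeroRows {i} addColumn addColumn-zeros columnState columnState-∷

  ∧-split : ∀ {a b} → a ∧ b ≡ true → a ≡ true × b ≡ true
  ∧-split {true} b≡true = refl , b≡true

  ⌊≟⌋⇒≡ : ∀ {m n} → ⌊ m ≟ n ⌋ ≡ true → m ≡ n
  ⌊≟⌋⇒≡ {m} {n} h with m ≟ n
  ... | yes m≡n = m≡n

  anyV⇒1≤onesRow : ∀ {p} (r : Vec Bool p) → anyV r ≡ true → 1 ≤ onesRow r
  anyV⇒1≤onesRow (true ∷ r)  _ = s≤s z≤n
  anyV⇒1≤onesRow (false ∷ r) h = anyV⇒1≤onesRow r h

  noZeroRow⇒rows≤ones : ∀ {m p} (M : Matrix01 m p) → noZeroRow M ≡ true → m ≤ ones M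
  noZeroRow⇒rows≤ones []      _ = z≤n
  noZeroRow⇒rows≤ones (r ∷ M) h =
    +-mono-≤ (anyV⇒1≤onesRow r (proj₁ (∧-split h))) (noZeroRow⇒rows≤ones M (proj₂ (∧-split {anyV r} h)))

  allV⇒length≤onesRow : ∀ {p} (v : Vec Bool p) → allV v ≡ true → p ≤ onesRow v
  allV⇒length≤onesRow []         _ = z≤n
  allV⇒length≤onesRow (true ∷ v) h = s≤s (allV⇒length≤onesRow v h)

  onesRow-zipWith-∨ : ∀ {p} (r v : Vec Bool p) → onesRow (zipWith _∨_ r v) ≤ onesRow r + onesRow v
  onesRow-zipWith-∨ []          []          = z≤n
  onesRow-zipWith-∨ (true ∷ r)  (true ∷ v)  = s≤s (≤-trans (onesRow-zipWith-∨ r v) (+-monoʳ-≤ (onesRow r) (n≤1+n _)))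
  onesRow-zipWith-∨ (true ∷ r)  (false ∷ v) = s≤s (onesRow-zipWith-∨ r v)
  onesRow-zipWith-∨ (false ∷ r) (true ∷ v)  = ≤-trans (s≤s (onesRow-zipWith-∨ r v)) (≤-reflexive (sym (+-suc _ _)))
  onesRow-zipWith-∨ (false ∷ r) (false ∷ v) = onesRow-zipWith-∨ r v

  onesRow-anyPerColumn : ∀ {m p} (M : Matrix01 m p) → onesRow (anyPerColumn M) ≤ ones M
  onesRow-anyPerColumn {p = p} [] = ≤-reflexive (onesRow-replicate-false p)
  onesRow-anyPerColumn (r ∷ M) =
    ≤-trans (onesRow-zipWith-∨ r (anyPerColumn M)) (+-monoʳ-≤ (onesRow r) (onesRow-anyPerColumn M))

  noZeroCol⇒columns≤ones : ∀ {m p} (M : Matrix01 m p) → noZeroCol M ≡ true → p ≤ ones M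
  noZeroCol⇒columns≤ones M h = ≤-trans (allV⇒length≤onesRow (anyPerColumn M) h) (onesRow-anyPerColumn M)

  valid⇒size≤ : ∀ n {m p} (M : Matrix01 m p) → Valid n M ≡ true → m ≤ n × p ≤ n
  valid⇒size≤ n M valid = subst (_ ≤_) ones≡n (noZeroRow⇒rows≤ones M rows)
                        , subst (_ ≤_) ones≡n (noZeroCol⇒columns≤ones M cols)
    where
    ones≡n = ⌊≟⌋⇒≡ (proj₁ (∧-split valid))
    rows = proj₁ (∧-split (proj₂ (∧-split {⌊ ones M ≟ n ⌋} valid)))
    cols = proj₂ (∧-split {noZeroRow M} (proj₂ (∧-split {⌊ ones M ≟ n ⌋} valid)))

  validCount : ℕ → ℕ → ℕ → ℕ
  validCount n i j = ∑Mat i j (λ M → indicator (Valid n M))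

  validCount-outside : ∀ n i j → ¬ (i ≤ n × j ≤ n) → validCount n i j ≡ 0
  validCount-outside n i j too-large = ∑Mat-zero i j (λ M → invalid M (Valid n M) refl)
    where
    invalid : ∀ M b → Valid n M ≡ b → indicator b ≡ 0
    invalid M true  valid = contradiction (valid⇒size≤ n M valid) too-large
    invalid M false _     = refl

  C≡∑∑C*validCount : ∀ n k l →
    (k * l) C n ≡ ∑ (suc k) (λ i → (k C i) * ∑ (suc l) (λ j → (l C j) * validCount n i j))
  C≡∑∑C*validCount n k l = begin
    (k * l) C n
      ≡⟨ ∑Mat-ones≡C k l n ⟨
    ByRows.count l k onesIs-n
      ≡⟨ ByRows.count≡∑C*countNoZeroRow l k onesIs-n ⟩
    ∑ (suc k) (λ i → (k C i) * ByRows.countNoZeroRow l i onesIs-n)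
      ≡⟨ ∑-cong (suc k) (λ i → cong ((k C i) *_) (begin
        ByRows.countNoZeroRow l i onesIs-n
          ≡⟨ ∑Mat-transpose i l _ ⟩
        ByColumns.count i l onesIs-n∧rowsNonzero
          ≡⟨ ByColumns.count≡∑C*countNoZeroRow i l onesIs-n∧rowsNonzero ⟩
        ∑ (suc l) (λ j → (l C j) * ByColumns.countNoZeroRow i j onesIs-n∧rowsNonzero)
          ≡⟨ ∑-cong (suc l) (λ j → cong ((l C j) *_) (sym (transposed-valid i j))) ⟩
        ∑ (suc l) (λ j → (l C j) * validCount n i j)
          ∎)) ⟩
    ∑ (suc k) (λ i → (k C i) * ∑ (suc l) (λ j → (l C j) * validCount n i j))
      ∎
    where
    onesIs-n : ℕ → Bool
    onesIs-n x = ⌊ x ≟ n ⌋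
    onesIs-n∧rowsNonzero : ∀ {i} → Vec Bool i × ℕ → Bool
    onesIs-n∧rowsNonzero (u , x) = ⌊ x ≟ n ⌋ ∧ allV u
    transposed-valid : ∀ i j → validCount n i j ≡ ByColumns.countNoZeroRow i j onesIs-n∧rowsNonzero
    transposed-valid i j = trans (∑Mat-transpose i j _) (∑Mat-cong j i (λ M → cong indicator (trans
      (cong (λ b → ⌊ ones (transpose M) ≟ n ⌋ ∧ noZeroRow (transpose M) ∧ b) (noZeroCol-transpose M))
      (sym (∧-assoc ⌊ ones (transpose M) ≟ n ⌋ (noZeroRow (transpose M)) (noZeroRow M))))))

  C≡∑∑C*C*validCount : ∀ n k l →
    (k * l) C n ≡ ∑ (suc n) (λ i → ∑ (suc n) (λ j → (k C i) * (l C j) * validCount n i j))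
  C≡∑∑C*C*validCount n k l = begin
    (k * l) C n
      ≡⟨ C≡∑∑C*validCount n k l ⟩
    ∑ (suc k) (λ i → (k C i) * ∑ (suc l) (λ j → (l C j) * validCount n i j))
      ≡⟨ ∑-cong (suc k) (λ i → trans (*-distribˡ-∑ (suc l) (k C i) (λ j → (l C j) * validCount n i j))
                                      (∑-cong (suc l) (λ j → sym (*-assoc (k C i) (l C j) (validCount n i j))))) ⟩
    ∑ (suc k) (λ i → ∑ (suc l) (summand i))
      ≡⟨ ∑-resize (suc k) (suc n) (λ i k<i → ∑-zero (suc l) (λ j → C-vanishes i j k<i))
                                  (λ i n<i → ∑-zero (suc l) (λ j → B-vanishes i j (λ (i≤n , _) → <⇒≱ n<i i≤n))) ⟩
    ∑ (suc n) (λ i → ∑ (suc l) (summand i))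
      ≡⟨ ∑-cong (suc n) (λ i → ∑-resize (suc l) (suc n)
           (λ j l<j → trans (cong (λ c → (k C i) * c * validCount n i j) (k>n⇒nCk≡0 l<j))
                             (cong (_* validCount n i j) (*-zeroʳ (k C i))))
           (λ j n<j → B-vanishes i j (λ (_ , j≤n) → <⇒≱ n<j j≤n))) ⟩
    ∑ (suc n) (λ i → ∑ (suc n) (summand i))
      ∎
    where
    summand : ℕ → ℕ → ℕ
    summand i j = (k C i) * (l C j) * validCount n i j
    C-vanishes : ∀ i j → k < i → summand i j ≡ 0
    C-vanishes i j k<i = cong (λ c → c * (l C j) * validCount n i j) (k>n⇒nCk≡0 k<i)
    B-vanishes : ∀ i j → ¬ (i ≤ n × j ≤ n) → summand i j ≡ 0
    B-vanishes i j too-large =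
      trans (cong ((k C i) * (l C j) *_) (validCount-outside n i j too-large)) (*-zeroʳ ((k C i) * (l C j)))

module Enumeration where

  open import Defs
  open import Data.Bool using (Bool; true; false)
  open import Data.Empty using (⊥)
  open import Data.Fin using (Fin; zero)
  open import Data.Fin.Properties using (+↔⊎; 0↔⊥)
  open import Data.Nat using (ℕ; zero; suc; _+_; _<_; z≤n; s≤s)
  open import Data.Nat.Properties using (+-*-commutativeSemiring; ≤-irrelevant; ≤-pred)
  open import Data.Product using (Σ; _×_; _,_)
  open import Data.Product.Function.Dependent.Propositional using (Σ-↔)
  open import Data.Product.Function.NonDependent.Propositional using (_×-↔_)
  open import Data.Sum using (_⊎_; inj₁; inj₂)
  open import Data.Sum.Function.Propositional using (_⊎-↔_)
  open import Data.Vec using (Vec; []; _∷_)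
  open import Function using (_∘_)
  open import Function.Bundles using (_↔_; mk↔ₛ′)
  open import Function.Properties.Inverse using (↔-refl; ↔-sym)
  open import Function.Related.Propositional using (module EquationalReasoning)
  open import Relation.Binary.PropositionalEquality using (_≡_; refl; cong; cong₂)
  open EquationalReasoning
  open RangeSum +-*-commutativeSemiring
  open Matrices

  Σ< : ℕ → (ℕ → Set) → Set
  Σ< N X = Σ ℕ (λ m → m < N × X m)

  Σ<-cong : ∀ {N} {X Y : ℕ → Set} → (∀ m → X m ↔ Y m) → Σ< N X ↔ Σ< N Y
  Σ<-cong X↔Y = Σ-↔ ↔-refl (↔-refl ×-↔ X↔Y _)

  Σ<-zero↔⊥ : ∀ {X} → Σ< 0 X ↔ ⊥
  Σ<-zero↔⊥ = mk↔ₛ′ (λ { (_ , () , _) }) (λ ()) (λ ()) (λ { (_ , () , _) })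

  Σ<-suc↔⊎ : ∀ {N X} → Σ< (suc N) X ↔ (X 0 ⊎ Σ< N (X ∘ suc))
  Σ<-suc↔⊎ {N} {X} = mk↔ₛ′ split join split-join join-split
    where
    split : Σ< (suc N) X → X 0 ⊎ Σ< N (X ∘ suc)
    split (zero  , _   , x) = inj₁ x
    split (suc m , m<N , x) = inj₂ (m , ≤-pred m<N , x)
    join : X 0 ⊎ Σ< N (X ∘ suc) → Σ< (suc N) X
    join (inj₁ x)           = zero , s≤s z≤n , x
    join (inj₂ (m , m<N , x)) = suc m , s≤s m<N , x
    split-join : ∀ y → split (join y) ≡ y
    split-join (inj₁ _) = refl
    split-join (inj₂ _) = refl
    join-split : ∀ p → join (split p) ≡ p
    join-split (zero  , 0<N   , x) = cong (λ 0<N → zero , 0<N , x) (≤-irrelevant _ _)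
    join-split (suc m , s≤s _ , x) = refl

  Σ-Vec-zero↔ : ∀ {A : Set} {P : Vec A 0 → Set} → Σ (Vec A 0) P ↔ P []
  Σ-Vec-zero↔ = mk↔ₛ′ (λ { ([] , p) → p }) ([] ,_) (λ _ → refl) (λ { ([] , _) → refl })

  Σ-Vec-∷↔ : ∀ {A : Set} {k} {P : Vec A (suc k) → Set} →
             Σ (Vec A (suc k)) P ↔ Σ A (λ a → Σ (Vec A k) (λ v → P (a ∷ v)))
  Σ-Vec-∷↔ = mk↔ₛ′ (λ { (a ∷ v , p) → a , v , p }) (λ { (a , v , p) → a ∷ v , p })
                   (λ _ → refl) (λ { (_ ∷ _ , _) → refl })

  Σ-Bool↔⊎ : ∀ {P : Bool → Set} → Σ Bool P ↔ (P false ⊎ P true)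
  Σ-Bool↔⊎ = mk↔ₛ′ (λ { (false , p) → inj₁ p ; (true , p) → inj₂ p })
                   (λ { (inj₁ p) → false , p ; (inj₂ p) → true , p })
                   (λ { (inj₁ _) → refl ; (inj₂ _) → refl })
                   (λ { (false , _) → refl ; (true , _) → refl })

  Fin-∑↔Σ< : ∀ N (f : ℕ → ℕ) → Fin (∑ N f) ↔ Σ< N (Fin ∘ f)
  Fin-∑↔Σ< zero    f = begin
    Fin 0            ↔⟨ 0↔⊥ ⟩
    ⊥                ↔⟨ Σ<-zero↔⊥ ⟨
    Σ< 0 (Fin ∘ f)   ∎
  Fin-∑↔Σ< (suc N) f = begin
    Fin (f 0 + ∑ N (f ∘ suc))          ↔⟨ +↔⊎ ⟩
    (Fin (f 0) ⊎ Fin (∑ N (f ∘ suc)))  ↔⟨ ↔-refl ⊎-↔ Fin-∑↔Σ< N (f ∘ suc) ⟩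
    (Fin (f 0) ⊎ Σ< N (Fin ∘ f ∘ suc)) ↔⟨ Σ<-suc↔⊎ ⟨
    Σ< (suc N) (Fin ∘ f)               ∎

  Fin-∑Vec↔Σ : ∀ l (g : Vec Bool l → ℕ) → Fin (∑Vec l g) ↔ Σ (Vec Bool l) (Fin ∘ g)
  Fin-∑Vec↔Σ zero    g = ↔-sym Σ-Vec-zero↔
  Fin-∑Vec↔Σ (suc l) g = begin
    Fin (∑Vec l (g ∘ (false ∷_)) + ∑Vec l (g ∘ (true ∷_)))
      ↔⟨ +↔⊎ ⟩
    (Fin (∑Vec l (g ∘ (false ∷_))) ⊎ Fin (∑Vec l (g ∘ (true ∷_))))
      ↔⟨ Fin-∑Vec↔Σ l _ ⊎-↔ Fin-∑Vec↔Σ l _ ⟩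
    (Σ (Vec Bool l) (Fin ∘ g ∘ (false ∷_)) ⊎ Σ (Vec Bool l) (Fin ∘ g ∘ (true ∷_)))
      ↔⟨ Σ-Bool↔⊎ ⟨
    Σ Bool (λ b → Σ (Vec Bool l) (Fin ∘ g ∘ (b ∷_)))
      ↔⟨ Σ-Vec-∷↔ ⟨
    Σ (Vec Bool (suc l)) (Fin ∘ g)
      ∎

  Fin-∑Mat↔Σ : ∀ k l (f : Matrix01 k l → ℕ) → Fin (∑Mat k l f) ↔ Σ (Matrix01 k l) (Fin ∘ f)
  Fin-∑Mat↔Σ zero    l f = ↔-sym Σ-Vec-zero↔
  Fin-∑Mat↔Σ (suc k) l f = begin
    Fin (∑Vec l (λ r → ∑Mat k l (f ∘ (r ∷_))))        ↔⟨ Fin-∑Vec↔Σ l _ ⟩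
    Σ (Vec Bool l) (λ r → Fin (∑Mat k l (f ∘ (r ∷_)))) ↔⟨ Σ-↔ ↔-refl (Fin-∑Mat↔Σ k l _) ⟩
    Σ (Vec Bool l) (λ r → Σ (Matrix01 k l) (Fin ∘ f ∘ (r ∷_))) ↔⟨ Σ-Vec-∷↔ ⟨
    Σ (Matrix01 (suc k) l) (Fin ∘ f)                   ∎

  Fin-indicator↔ : ∀ b → Fin (indicator b) ↔ (b ≡ true)
  Fin-indicator↔ true  = mk↔ₛ′ (λ _ → refl) (λ _ → zero) (λ { refl → refl }) (λ { zero → refl })
  Fin-indicator↔ false = mk↔ₛ′ (λ ()) (λ ()) (λ ()) (λ ())

  validTotal : ℕ → ℕ
  validTotal n = ∑ (suc n) (λ i → ∑ (suc n) (validCount n i))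

  Fin-validTotal↔Counted : ∀ n → Fin (validTotal n) ↔ Counted n
  Fin-validTotal↔Counted n = begin
    Fin (validTotal n)
      ↔⟨ Fin-∑↔Σ< (suc n) _ ⟩
    Σ< (suc n) (λ i → Fin (∑ (suc n) (validCount n i)))
      ↔⟨ Σ<-cong (λ i → Fin-∑↔Σ< (suc n) _) ⟩
    Σ< (suc n) (λ i → Σ< (suc n) (λ j → Fin (validCount n i j)))
      ↔⟨ Σ<-cong (λ i → Σ<-cong (λ j → Fin-∑Mat↔Σ i j _)) ⟩
    Σ< (suc n) (λ i → Σ< (suc n) (λ j → Σ (Matrix01 i j) (Fin ∘ indicator ∘ Valid n)))
      ↔⟨ Σ<-cong (λ i → Σ<-cong (λ j → Σ-↔ ↔-refl (Fin-indicator↔ _))) ⟩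
    Σ< (suc n) (λ i → Σ< (suc n) (λ j → Σ (Matrix01 i j) (λ M → Valid n M ≡ true)))
      ↔⟨ bounded↔Counted ⟩
    Counted n
      ∎
    where
    bounded↔Counted : Σ< (suc n) (λ i → Σ< (suc n) (λ j → Σ (Matrix01 i j) (λ M → Valid n M ≡ true)))
                      ↔ Counted n
    bounded↔Counted = mk↔ₛ′ (λ { (i , _ , j , _ , M) → i , j , M })
      (λ { (i , j , M , valid) → let (i≤n , j≤n) = valid⇒size≤ n M valid
                                  in i , s≤s i≤n , j , s≤s j≤n , M , valid })
      (λ _ → refl)
      (λ { (i , _ , j , _ , M) → cong₂ (λ i<n+1 j<n+1 → i , i<n+1 , j , j<n+1 , M)
                                        (≤-irrelevant _ _) (≤-irrelevant _ _) })

module BinomialTail where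

  open import Data.Nat using (ℕ; zero; suc; _+_; _*_; _^_; _≤_; _<_; z≤n; s≤s)
  open import Data.Nat.Properties
  open import Data.Nat.Combinatorics using (_C_; nCk+nC[k+1]≡[n+1]C[k+1]; nC1≡n)
  open import Data.Nat.Tactic.RingSolver using (solve-∀)
  open import Data.Product using (Σ; _,_)
  open import Relation.Binary.PropositionalEquality
  open import Algebra.Properties.CommutativeSemigroup *-commutativeSemigroup using (x∙yz≈y∙xz)
  open RangeSum +-*-commutativeSemiring

  binomialSum : ℕ → ℕ → ℕ
  binomialSum N i = ∑ (suc i) (N C_)

  binomialSum-zero : ∀ i → binomialSum 0 i ≡ 1
  binomialSum-zero i = cong suc (∑-zero i (λ _ → refl))

  binomialSum-suc : ∀ N i → binomialSum (suc N) i + N C i ≡ 2 * binomialSum N i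
  binomialSum-suc N zero    = refl
  binomialSum-suc N (suc i) = begin
    binomialSum (suc N) (suc i) + N C suc i
      ≡⟨ cong (_+ N C suc i) (∑-last (suc i) (suc N C_)) ⟩
    (binomialSum (suc N) i + suc N C suc i) + N C suc i
      ≡⟨ cong (λ c → (binomialSum (suc N) i + c) + N C suc i) (nCk+nC[k+1]≡[n+1]C[k+1] N i) ⟨
    (binomialSum (suc N) i + (N C i + N C suc i)) + N C suc i
      ≡⟨ regroup (binomialSum (suc N) i) (N C i) (N C suc i) ⟩
    (binomialSum (suc N) i + N C i) + 2 * (N C suc i)
      ≡⟨ cong (_+ 2 * (N C suc i)) (binomialSum-suc N i) ⟩
    2 * binomialSum N i + 2 * (N C suc i)
      ≡⟨ *-distribˡ-+ 2 (binomialSum N i) (N C suc i) ⟨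
    2 * (binomialSum N i + N C suc i)
      ≡⟨ cong (2 *_) (∑-last (suc i) (N C_)) ⟨
    2 * binomialSum N (suc i)
      ∎
    where
    open ≡-Reasoning
    regroup : ∀ q a b → (q + (a + b)) + b ≡ (q + a) + 2 * b
    regroup = solve-∀

  ∑-mono-length : ∀ {M N} (f : ℕ → ℕ) → M ≤ N → ∑ M f ≤ ∑ N f
  ∑-mono-length f z≤n       = z≤n
  ∑-mono-length f (s≤s M≤N) = +-monoʳ-≤ (f 0) (∑-mono-length (λ i → f (suc i)) M≤N)

  ∑-bounded : ∀ N {f : ℕ → ℕ} {c} → (∀ i → i < N → f i ≤ c) → ∑ N f ≤ N * c
  ∑-bounded zero    f≤c = z≤n
  ∑-bounded (suc N) f≤c = +-mono-≤ (f≤c 0 (s≤s z≤n)) (∑-bounded N (λ i i<N → f≤c (suc i) (s≤s i<N)))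

  binomialSum-mono : ∀ N {i n} → i ≤ n → binomialSum N i ≤ binomialSum N n
  binomialSum-mono N i≤n = ∑-mono-length (N C_) (s≤s i≤n)

  nCk≤2^n : ∀ N k → N C k ≤ 2 ^ N
  nCk≤2^n zero    zero    = ≤-refl
  nCk≤2^n zero    (suc k) = z≤n
  nCk≤2^n (suc N) zero    = m^n>0 2 (suc N)
  nCk≤2^n (suc N) (suc k) = begin
    suc N C suc k     ≡⟨ nCk+nC[k+1]≡[n+1]C[k+1] N k ⟨
    N C k + N C suc k ≤⟨ +-mono-≤ (nCk≤2^n N k) (nCk≤2^n N (suc k)) ⟩
    2 ^ N + 2 ^ N     ≡⟨ cong (2 ^ N +_) (+-identityʳ (2 ^ N)) ⟨
    2 ^ suc N         ∎
    where open ≤-Reasoning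

  [n+1]*nCk≡[k+1]*[n+1]C[k+1] : ∀ N j → suc N * (N C j) ≡ suc j * (suc N C suc j)
  [n+1]*nCk≡[k+1]*[n+1]C[k+1] zero    zero    = refl
  [n+1]*nCk≡[k+1]*[n+1]C[k+1] zero    (suc j) = sym (*-zeroʳ (suc (suc j)))
  [n+1]*nCk≡[k+1]*[n+1]C[k+1] (suc N) zero    =
    trans (*-identityʳ (suc (suc N))) (sym (trans (+-identityʳ _) (nC1≡n (suc (suc N)))))
  [n+1]*nCk≡[k+1]*[n+1]C[k+1] (suc N) (suc j) = begin
    suc (suc N) * (suc N C suc j)
      ≡⟨ cong (suc (suc N) *_) (nCk+nC[k+1]≡[n+1]C[k+1] N j) ⟨
    suc (suc N) * (N C j + N C suc j)
      ≡⟨ expand N (N C j) (N C suc j) ⟩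
    suc N * (N C j) + suc N * (N C suc j) + (N C j + N C suc j)
      ≡⟨ cong₂ (λ a b → a + b + (N C j + N C suc j))
               ([n+1]*nCk≡[k+1]*[n+1]C[k+1] N j) ([n+1]*nCk≡[k+1]*[n+1]C[k+1] N (suc j)) ⟩
    suc j * (suc N C suc j) + suc (suc j) * (suc N C suc (suc j)) + (N C j + N C suc j)
      ≡⟨ cong (suc j * (suc N C suc j) + suc (suc j) * (suc N C suc (suc j)) +_) (nCk+nC[k+1]≡[n+1]C[k+1] N j) ⟩
    suc j * (suc N C suc j) + suc (suc j) * (suc N C suc (suc j)) + suc N C suc j
      ≡⟨ collect j (suc N C suc j) (suc N C suc (suc j)) ⟩
    suc (suc j) * (suc N C suc j + suc N C suc (suc j))
      ≡⟨ cong (suc (suc j) *_) (nCk+nC[k+1]≡[n+1]C[k+1] (suc N) (suc j)) ⟩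
    suc (suc j) * (suc (suc N) C suc (suc j))
      ∎
    where
    open ≡-Reasoning
    expand : ∀ N x y → suc (suc N) * (x + y) ≡ suc N * x + suc N * y + (x + y)
    expand = solve-∀
    collect : ∀ j u w → suc j * u + suc (suc j) * w + u ≡ suc (suc j) * (u + w)
    collect = solve-∀

  N*binomialSum≤ : ∀ N n → N * binomialSum N n ≤ suc n * suc n * 2 * 2 ^ N
  N*binomialSum≤ N n = begin
    N * binomialSum N n              ≡⟨ *-distribˡ-∑ (suc n) N (N C_) ⟩
    ∑ (suc n) (λ j → N * (N C j))    ≤⟨ ∑-bounded (suc n) term≤ ⟩
    suc n * (suc n * 2 ^ suc N)      ≡⟨ regroup (suc n) (2 ^ N) ⟩
    suc n * suc n * 2 * 2 ^ N        ∎
    where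
    open ≤-Reasoning
    regroup : ∀ a b → a * (a * (2 * b)) ≡ a * a * 2 * b
    regroup = solve-∀
    term≤ : ∀ j → j < suc n → N * (N C j) ≤ suc n * 2 ^ suc N
    term≤ j j<n+1 = begin
      N * (N C j)                ≤⟨ *-monoˡ-≤ (N C j) (n≤1+n N) ⟩
      suc N * (N C j)            ≡⟨ [n+1]*nCk≡[k+1]*[n+1]C[k+1] N j ⟩
      suc j * (suc N C suc j)    ≤⟨ *-mono-≤ j<n+1 (nCk≤2^n (suc N) (suc j)) ⟩
      suc n * 2 ^ suc N          ∎

  binomialSum-small : ∀ n c → Σ ℕ λ N → c * binomialSum N n < 2 ^ N
  binomialSum-small n c = N , *-cancelˡ-< N (c * binomialSum N n) (2 ^ N) (begin-strict
    N * (c * binomialSum N n) ≡⟨ x∙yz≈y∙xz N c (binomialSum N n) ⟩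
    c * (N * binomialSum N n) ≤⟨ *-monoʳ-≤ c (N*binomialSum≤ N n) ⟩
    c * (K * 2 ^ N)           ≡⟨ *-assoc c K (2 ^ N) ⟨
    c * K * 2 ^ N             <⟨ *-monoˡ-< (2 ^ N) {{m^n≢0 2 N}} (n<1+n (c * K)) ⟩
    N * 2 ^ N                 ∎)
    where
    open ≤-Reasoning
    K = suc n * suc n * 2
    N = suc (c * K)

module Series where

  open import Algebra.Bundles using (CommutativeRing; CommutativeMonoid)
  open import Data.Nat as ℕ using (ℕ; zero; suc; z≤n; s≤s)
  import Data.Nat.Properties as ℕ
  open import Data.Nat.Combinatorics using (_C_)
  import Data.Nat.Coprimality as Coprime
  import Data.Integer as ℤ
  import Data.Integer.Properties as ℤ
  open import Data.Rational using (ℚ; 0ℚ; 1ℚ; ½; mkℚ; _/_; _+_; _*_; _-_; -_; _≤_; _<_; nonNegative; positive)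
  import Data.Rational.Properties as ℚ
  import Data.Rational.Unnormalised as ℚᵘ
  import Data.Rational.Unnormalised.Properties as ℚᵘ
  open import Data.Rational.Solver using (module +-*-Solver)
  open import Data.Empty using (⊥-elim)
  open import Data.Product using (Σ; _,_; proj₁; proj₂)
  open import Function using (_∘_)
  open import Relation.Binary.PropositionalEquality
  open import Defs using (halfPow; term; sumTo; partial)
  open import Data.Nat.Tactic.RingSolver using (solve-∀)
  open +-*-Solver using (solve; _:+_; _:*_; _:-_; _:=_)
  open import Algebra.Properties.Semiring.Mult (CommutativeRing.semiring ℚ.+-*-commutativeRing)
    using (_×_; ×-homo-+; ×1-homo-*)
  open import Algebra.Properties.CommutativeSemigroup
    (CommutativeMonoid.commutativeSemigroup ℚ.*-1-commutativeMonoid) using (interchange)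
  open RangeSum (CommutativeRing.commutativeSemiring ℚ.+-*-commutativeRing)
  module ℕ∑ = RangeSum ℕ.+-*-commutativeSemiring
  open Matrices using (validCount; C≡∑∑C*C*validCount)
  open Enumeration using (validTotal)
  open BinomialTail using (binomialSum; binomialSum-zero; binomialSum-suc; binomialSum-mono; binomialSum-small)

  fromℕ : ℕ → ℚ
  fromℕ n = n × 1ℚ

  fromℕ-+ : ∀ a b → fromℕ (a ℕ.+ b) ≡ fromℕ a + fromℕ b
  fromℕ-+ a b = ×-homo-+ 1ℚ a b

  fromℕ-* : ∀ a b → fromℕ (a ℕ.* b) ≡ fromℕ a * fromℕ b
  fromℕ-* = ×1-homo-*

  fromℕ-∑ : ∀ N (f : ℕ → ℕ) → fromℕ (ℕ∑.∑ N f) ≡ ∑ N (fromℕ ∘ f)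
  fromℕ-∑ zero    f = refl
  fromℕ-∑ (suc N) f = trans (fromℕ-+ (f 0) _) (cong (fromℕ (f 0) +_) (fromℕ-∑ N (f ∘ suc)))

  fromℕ-nonNeg : ∀ a → 0ℚ ≤ fromℕ a
  fromℕ-nonNeg zero    = ℚ.≤-refl
  fromℕ-nonNeg (suc a) = ℚ.+-mono-≤ (ℚ.<⇒≤ (ℚ.positive⁻¹ 1ℚ)) (fromℕ-nonNeg a)

  fromℕ-mono-≤ : ∀ {a b} → a ℕ.≤ b → fromℕ a ≤ fromℕ b
  fromℕ-mono-≤ {b = b} z≤n = fromℕ-nonNeg b
  fromℕ-mono-≤ (s≤s a≤b)   = ℚ.+-monoʳ-≤ 1ℚ (fromℕ-mono-≤ a≤b)

  fromℕ-mono-< : ∀ {a b} → a ℕ.< b → fromℕ a < fromℕ b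
  fromℕ-mono-< {a} a<b = ℚ.<-≤-trans a<1+a (fromℕ-mono-≤ a<b)
    where
    a<1+a : fromℕ a < 1ℚ + fromℕ a
    a<1+a = subst (_< 1ℚ + fromℕ a) (ℚ.+-identityˡ (fromℕ a)) (ℚ.+-monoˡ-< (fromℕ a) (ℚ.positive⁻¹ 1ℚ))

  mkℚ/1 : ℕ → ℚ
  mkℚ/1 a = mkℚ (ℤ.+ a) 0 (Coprime.sym (Coprime.1-coprimeTo a))

  fromℕ≡mkℚ/1 : ∀ a → fromℕ a ≡ mkℚ/1 a
  fromℕ≡mkℚ/1 zero    = refl
  fromℕ≡mkℚ/1 (suc a) = trans (cong (1ℚ +_) (fromℕ≡mkℚ/1 a)) (ℚ.toℚᵘ-injective (ℚᵘ.≃-trans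
    (ℚ.toℚᵘ-homo-+ 1ℚ (mkℚ/1 a))
    (ℚᵘ.*≡* (trans (ℤ.*-identityʳ _)
      (trans (cong (ℤ._+_ (ℤ.+ 1)) (ℤ.*-identityʳ (ℤ.+ a))) (sym (ℤ.*-identityʳ _)))))))

  +n/1≡fromℕ : ∀ n → ℤ.+ n / 1 ≡ fromℕ n
  +n/1≡fromℕ n = trans (ℚ.↥p/↧p≡p _) (sym (fromℕ≡mkℚ/1 n))

  halfPow-+ : ∀ a b → halfPow (a ℕ.+ b) ≡ halfPow a * halfPow b
  halfPow-+ zero    b = sym (ℚ.*-identityˡ (halfPow b))
  halfPow-+ (suc a) b = trans (cong (½ *_) (halfPow-+ a b)) (sym (ℚ.*-assoc ½ (halfPow a) (halfPow b)))

  halfPow-pos : ∀ k → 0ℚ < halfPow k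
  halfPow-pos zero    = ℚ.positive⁻¹ 1ℚ
  halfPow-pos (suc k) = ℚ.*-monoʳ-<-pos ½ (halfPow-pos k)

  halfPow-nonNeg : ∀ k → 0ℚ ≤ halfPow k
  halfPow-nonNeg k = ℚ.<⇒≤ (halfPow-pos k)

  *-nonNeg : ∀ {a b} → 0ℚ ≤ a → 0ℚ ≤ b → 0ℚ ≤ a * b
  *-nonNeg {a} {b} 0≤a 0≤b =
    ℚ.nonNegative⁻¹ (a * b) {{ℚ.nonNeg*nonNeg⇒nonNeg a {{nonNegative 0≤a}} b {{nonNegative 0≤b}}}}

  2*x*½*y≡x*y : ∀ x y → (fromℕ 2 * x) * (½ * y) ≡ x * y
  2*x*½*y≡x*y x y = trans (interchange (fromℕ 2) x ½ y) (ℚ.*-identityˡ (x * y))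

  2^*halfPow : ∀ N → fromℕ (2 ℕ.^ N) * halfPow N ≡ 1ℚ
  2^*halfPow zero    = refl
  2^*halfPow (suc N) = begin
    fromℕ (2 ℕ.* 2 ℕ.^ N) * (½ * halfPow N)        ≡⟨ cong (_* (½ * halfPow N)) (fromℕ-* 2 (2 ℕ.^ N)) ⟩
    (fromℕ 2 * fromℕ (2 ℕ.^ N)) * (½ * halfPow N)  ≡⟨ 2*x*½*y≡x*y (fromℕ (2 ℕ.^ N)) (halfPow N) ⟩
    fromℕ (2 ℕ.^ N) * halfPow N                    ≡⟨ 2^*halfPow N ⟩
    1ℚ                                              ∎
    where open ≡-Reasoning

  ∑-mono-≤ : ∀ N {f g : ℕ → ℚ} → (∀ i → i ℕ.< N → f i ≤ g i) → ∑ N f ≤ ∑ N g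
  ∑-mono-≤ zero    f≤g = ℚ.≤-refl
  ∑-mono-≤ (suc N) f≤g = ℚ.+-mono-≤ (f≤g 0 (s≤s z≤n)) (∑-mono-≤ N (λ i i<N → f≤g (suc i) (s≤s i<N)))

  ∑-nonNeg : ∀ N {f : ℕ → ℚ} → (∀ i → 0ℚ ≤ f i) → 0ℚ ≤ ∑ N f
  ∑-nonNeg zero    0≤f = ℚ.≤-refl
  ∑-nonNeg (suc N) 0≤f = ℚ.+-mono-≤ (0≤f 0) (∑-nonNeg N (0≤f ∘ suc))

  weight : ℕ → ℕ → ℚ
  weight k i = fromℕ (k C i) * halfPow (suc k)

  weightSum : ℕ → ℕ → ℚ
  weightSum N i = ∑ N (λ k → weight k i)

  weightTail : ℕ → ℕ → ℚ
  weightTail N i = fromℕ (binomialSum N i) * halfPow N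

  weightSum+weightTail≡1 : ∀ N i → weightSum N i + weightTail N i ≡ 1ℚ
  weightSum+weightTail≡1 zero    i = cong (λ q → 0ℚ + fromℕ q * 1ℚ) (binomialSum-zero i)
  weightSum+weightTail≡1 (suc N) i = begin
    weightSum (suc N) i + weightTail (suc N) i
      ≡⟨ cong (_+ weightTail (suc N) i) (∑-last N (λ k → weight k i)) ⟩
    (weightSum N i + fromℕ (N C i) * h) + fromℕ (binomialSum (suc N) i) * h
      ≡⟨ factor (weightSum N i) (fromℕ (N C i)) (fromℕ (binomialSum (suc N) i)) h ⟩
    weightSum N i + (fromℕ (binomialSum (suc N) i) + fromℕ (N C i)) * h
      ≡⟨ cong (λ q → weightSum N i + q * h) (trans (sym (fromℕ-+ (binomialSum (suc N) i) (N C i)))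
                                                 (cong fromℕ (binomialSum-suc N i))) ⟩
    weightSum N i + fromℕ (2 ℕ.* binomialSum N i) * (½ * halfPow N)
      ≡⟨ cong (λ q → weightSum N i + q * (½ * halfPow N)) (fromℕ-* 2 (binomialSum N i)) ⟩
    weightSum N i + (fromℕ 2 * fromℕ (binomialSum N i)) * (½ * halfPow N)
      ≡⟨ cong (weightSum N i +_) (2*x*½*y≡x*y (fromℕ (binomialSum N i)) (halfPow N)) ⟩
    weightSum N i + weightTail N i
      ≡⟨ weightSum+weightTail≡1 N i ⟩
    1ℚ
      ∎
    where
    open ≡-Reasoning
    h = halfPow (suc N)
    factor : ∀ s c q h → (s + c * h) + q * h ≡ s + (q + c) * h
    factor = solve 4 (λ s c q h → (s :+ c :* h) :+ q :* h := s :+ (q :+ c) :* h) refl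

  weightSum-nonNeg : ∀ N i → 0ℚ ≤ weightSum N i
  weightSum-nonNeg N i = ∑-nonNeg N (λ k → *-nonNeg (fromℕ-nonNeg (k C i)) (halfPow-nonNeg (suc k)))

  weightTail-nonNeg : ∀ N i → 0ℚ ≤ weightTail N i
  weightTail-nonNeg N i = *-nonNeg (fromℕ-nonNeg (binomialSum N i)) (halfPow-nonNeg N)

  weightSum≤1 : ∀ N i → weightSum N i ≤ 1ℚ
  weightSum≤1 N i = subst₂ _≤_ (ℚ.+-identityʳ (weightSum N i)) (weightSum+weightTail≡1 N i)
                             (ℚ.+-monoʳ-≤ (weightSum N i) (weightTail-nonNeg N i))

  weightTail-mono : ∀ N {i n} → i ℕ.≤ n → weightTail N i ≤ weightTail N n
  weightTail-mono N i≤n = ℚ.*-monoʳ-≤-nonNeg (halfPow N) {{nonNegative (halfPow-nonNeg N)}}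
                                              (fromℕ-mono-≤ (binomialSum-mono N i≤n))

  fromℕ-∑∑*ʳ : ∀ M (g : ℕ → ℕ → ℕ) x →
               fromℕ (ℕ∑.∑ M (λ i → ℕ∑.∑ M (g i))) * x ≡ ∑ M (λ i → ∑ M (λ j → fromℕ (g i j) * x))
  fromℕ-∑∑*ʳ M g x = begin
    fromℕ (ℕ∑.∑ M (λ i → ℕ∑.∑ M (g i))) * x      ≡⟨ cong (_* x) (fromℕ-∑ M _) ⟩
    ∑ M (λ i → fromℕ (ℕ∑.∑ M (g i))) * x          ≡⟨ *-distribʳ-∑ M x _ ⟩
    ∑ M (λ i → fromℕ (ℕ∑.∑ M (g i)) * x)          ≡⟨ ∑-cong M (λ i → trans (cong (_* x) (fromℕ-∑ M (g i)))
                                                                          (*-distribʳ-∑ M x _)) ⟩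
    ∑ M (λ i → ∑ M (λ j → fromℕ (g i j) * x))     ∎
    where open ≡-Reasoning

  term≡∑∑ : ∀ n k l →
    term n k l ≡ ∑ (suc n) (λ i → ∑ (suc n) (λ j → weight k i * weight l j * fromℕ (validCount n i j)))
  term≡∑∑ n k l = begin
    term n k l
      ≡⟨ cong₂ _*_ (+n/1≡fromℕ ((k ℕ.* l) C n))
                   (trans (cong halfPow (k+l+2≡1+k+1+l k l)) (halfPow-+ (suc k) (suc l))) ⟩
    fromℕ ((k ℕ.* l) C n) * (halfPow (suc k) * halfPow (suc l))
      ≡⟨ cong (λ c → fromℕ c * (halfPow (suc k) * halfPow (suc l))) (C≡∑∑C*C*validCount n k l) ⟩
    fromℕ (ℕ∑.∑ (suc n) (λ i → ℕ∑.∑ (suc n) (summand i))) * (halfPow (suc k) * halfPow (suc l))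
      ≡⟨ fromℕ-∑∑*ʳ (suc n) summand _ ⟩
    ∑ (suc n) (λ i → ∑ (suc n) (λ j → fromℕ (summand i j) * (halfPow (suc k) * halfPow (suc l))))
      ≡⟨ ∑-cong (suc n) (λ i → ∑-cong (suc n) (λ j → split-summand i j)) ⟩
    ∑ (suc n) (λ i → ∑ (suc n) (λ j → weight k i * weight l j * fromℕ (validCount n i j)))
      ∎
    where
    open ≡-Reasoning
    k+l+2≡1+k+1+l : ∀ k l → k ℕ.+ l ℕ.+ 2 ≡ suc k ℕ.+ suc l
    k+l+2≡1+k+1+l = solve-∀
    summand : ℕ → ℕ → ℕ
    summand i j = (k C i) ℕ.* (l C j) ℕ.* validCount n i j
    regroup : ∀ x y b p q → x * y * b * (p * q) ≡ x * p * (y * q) * b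
    regroup = solve 5 (λ x y b p q → x :* y :* b :* (p :* q) := x :* p :* (y :* q) :* b) refl
    split-summand : ∀ i j → fromℕ (summand i j) * (halfPow (suc k) * halfPow (suc l))
                            ≡ weight k i * weight l j * fromℕ (validCount n i j)
    split-summand i j = trans
      (cong (_* (halfPow (suc k) * halfPow (suc l)))
            (trans (fromℕ-* ((k C i) ℕ.* (l C j)) (validCount n i j))
                   (cong (_* fromℕ (validCount n i j)) (fromℕ-* (k C i) (l C j)))))
      (regroup (fromℕ (k C i)) (fromℕ (l C j)) (fromℕ (validCount n i j)) (halfPow (suc k)) (halfPow (suc l)))

  sumTo≡∑ : ∀ N f → sumTo N f ≡ ∑ N f
  sumTo≡∑ zero    f = refl
  sumTo≡∑ (suc N) f = trans (cong (_+ f N) (sumTo≡∑ N f)) (sym (∑-last N f))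

  partial≡∑∑ : ∀ n N →
    partial n N ≡ ∑ (suc n) (λ i → ∑ (suc n) (λ j → weightSum N i * weightSum N j * fromℕ (validCount n i j)))
  partial≡∑∑ n N = begin
    partial n N
      ≡⟨ trans (sumTo≡∑ N _) (∑-cong N (λ k → sumTo≡∑ N _)) ⟩
    ∑ N (λ k → ∑ N (λ l → term n k l))
      ≡⟨ ∑-cong N (λ k → ∑-cong N (λ l → term≡∑∑ n k l)) ⟩
    ∑ N (λ k → ∑ N (λ l → ∑ (suc n) (λ i → ∑ (suc n) (λ j → weight k i * weight l j * b i j))))
      ≡⟨ ∑∑-comm N (suc n) (λ k l i j → weight k i * weight l j * b i j) ⟩
    ∑ (suc n) (λ i → ∑ (suc n) (λ j → ∑ N (λ k → ∑ N (λ l → weight k i * weight l j * b i j))))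
      ≡⟨ ∑-cong (suc n) (λ i → ∑-cong (suc n) (λ j → begin
           ∑ N (λ k → ∑ N (λ l → weight k i * weight l j * b i j))
             ≡⟨ ∑-cong N (λ k → *-distribʳ-∑ N (b i j) _) ⟨
           ∑ N (λ k → ∑ N (λ l → weight k i * weight l j) * b i j)
             ≡⟨ *-distribʳ-∑ N (b i j) _ ⟨
           ∑ N (λ k → ∑ N (λ l → weight k i * weight l j)) * b i j
             ≡⟨ cong (_* b i j) (∑-*-∑ N N (λ k → weight k i) (λ l → weight l j)) ⟨
           weightSum N i * weightSum N j * b i j
             ∎)) ⟩
    ∑ (suc n) (λ i → ∑ (suc n) (λ j → weightSum N i * weightSum N j * b i j))
      ∎
    where
    open ≡-Reasoning
    b : ℕ → ℕ → ℚ
    b i j = fromℕ (validCount n i j)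

  fromℕ-validTotal≡∑∑ : ∀ n → fromℕ (validTotal n) ≡ ∑ (suc n) (λ i → ∑ (suc n) (λ j → fromℕ (validCount n i j)))
  fromℕ-validTotal≡∑∑ n = trans (fromℕ-∑ (suc n) (λ i → ℕ∑.∑ (suc n) (validCount n i)))
                               (∑-cong (suc n) (λ i → fromℕ-∑ (suc n) (validCount n i)))

  partial≤validTotal : ∀ n N → partial n N ≤ fromℕ (validTotal n)
  partial≤validTotal n N = subst₂ _≤_ (sym (partial≡∑∑ n N)) (sym (fromℕ-validTotal≡∑∑ n))
    (∑-mono-≤ (suc n) (λ i _ → ∑-mono-≤ (suc n) (λ j _ → summand≤ i j)))
    where
    summand≤ : ∀ i j → weightSum N i * weightSum N j * fromℕ (validCount n i j) ≤ fromℕ (validCount n i j)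
    summand≤ i j = ℚ.≤-trans
      (ℚ.*-monoʳ-≤-nonNeg (fromℕ (validCount n i j)) {{nonNegative (fromℕ-nonNeg (validCount n i j))}}
        (ℚ.≤-trans (ℚ.*-monoʳ-≤-nonNeg (weightSum N j) {{nonNegative (weightSum-nonNeg N j)}} (weightSum≤1 N i))
                   (ℚ.≤-trans (ℚ.≤-reflexive (ℚ.*-identityˡ (weightSum N j))) (weightSum≤1 N j))))
      (ℚ.≤-reflexive (ℚ.*-identityˡ (fromℕ (validCount n i j))))

  -- Expanding (S i + R i) (S j + R j) = 1 leaves 1 - S i S j = S i R j + R i, where R grows with i.
  1≤weightSum*weightSum+tails : ∀ N n {i j} → i ℕ.≤ n → j ℕ.≤ n →
                                1ℚ ≤ weightSum N i * weightSum N j + (weightTail N n + weightTail N n)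
  1≤weightSum*weightSum+tails N n {i} {j} i≤n j≤n = begin
    1ℚ                    ≡⟨ expand (S i) (R i) (S j) (R j) (weightSum+weightTail≡1 N i) (weightSum+weightTail≡1 N j) ⟨
    S i * S j + (S i * R j + R i)
      ≤⟨ ℚ.+-monoʳ-≤ (S i * S j) (ℚ.+-mono-≤ SR≤R (weightTail-mono N i≤n)) ⟩
    S i * S j + (R n + R n) ∎
    where
    open ℚ.≤-Reasoning
    S = weightSum N
    R = weightTail N
    expand : ∀ s r t u → s + r ≡ 1ℚ → t + u ≡ 1ℚ → s * t + (s * u + r) ≡ 1ℚ
    expand s r t u s+r≡1 t+u≡1 = trans (distribute s r t u)
      (trans (cong (λ x → s * x + r) t+u≡1) (trans (cong (_+ r) (ℚ.*-identityʳ s)) s+r≡1))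
      where
      distribute : ∀ s r t u → s * t + (s * u + r) ≡ s * (t + u) + r
      distribute = solve 4 (λ s r t u → s :* t :+ (s :* u :+ r) := s :* (t :+ u) :+ r) refl
    SR≤R : S i * R j ≤ R n
    SR≤R = ℚ.≤-trans (ℚ.*-monoʳ-≤-nonNeg (R j) {{nonNegative (weightTail-nonNeg N j)}} (weightSum≤1 N i))
             (ℚ.≤-trans (ℚ.≤-reflexive (ℚ.*-identityˡ (R j))) (weightTail-mono N j≤n))

  validTotal≤partial+tail : ∀ n N →
    fromℕ (validTotal n) ≤ partial n N + fromℕ (validTotal n ℕ.+ validTotal n) * weightTail N n
  validTotal≤partial+tail n N = begin
    fromℕ (validTotal n)
      ≡⟨ fromℕ-validTotal≡∑∑ n ⟩
    ∑ (suc n) (λ i → ∑ (suc n) (b i))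
      ≤⟨ ∑-mono-≤ (suc n) (λ i i<n+1 → ∑-mono-≤ (suc n) (λ j j<n+1 →
           summand≤ i j (ℕ.≤-pred i<n+1) (ℕ.≤-pred j<n+1))) ⟩
    ∑ (suc n) (λ i → ∑ (suc n) (λ j → S i * S j * b i j + E * b i j))
      ≡⟨ trans (∑-cong (suc n) (λ i → ∑-distrib-+ (suc n) (λ j → S i * S j * b i j) (λ j → E * b i j)))
               (∑-distrib-+ (suc n) (λ i → ∑ (suc n) (λ j → S i * S j * b i j)) (λ i → ∑ (suc n) (λ j → E * b i j))) ⟩
    ∑ (suc n) (λ i → ∑ (suc n) (λ j → S i * S j * b i j)) + ∑ (suc n) (λ i → ∑ (suc n) (λ j → E * b i j))
      ≡⟨ cong₂ _+_ (sym (partial≡∑∑ n N)) (sym factor-E) ⟩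
    partial n N + E * fromℕ (validTotal n)
      ≡⟨ cong (partial n N +_) (trans (rearrange (R n) (fromℕ (validTotal n)))
                                      (cong (_* R n) (sym (fromℕ-+ (validTotal n) (validTotal n))))) ⟩
    partial n N + fromℕ (validTotal n ℕ.+ validTotal n) * R n
      ∎
    where
    open ℚ.≤-Reasoning
    S = weightSum N
    R = weightTail N
    E = R n + R n
    b : ℕ → ℕ → ℚ
    b i j = fromℕ (validCount n i j)
    summand≤ : ∀ i j → i ℕ.≤ n → j ℕ.≤ n → b i j ≤ S i * S j * b i j + E * b i j
    summand≤ i j i≤n j≤n = begin
      b i j                        ≡⟨ ℚ.*-identityˡ (b i j) ⟨
      1ℚ * b i j                   ≤⟨ ℚ.*-monoʳ-≤-nonNeg (b i j) {{nonNegative (fromℕ-nonNeg (validCount n i j))}}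
                                        (1≤weightSum*weightSum+tails N n i≤n j≤n) ⟩
      (S i * S j + E) * b i j      ≡⟨ ℚ.*-distribʳ-+ (b i j) (S i * S j) E ⟩
      S i * S j * b i j + E * b i j ∎
    factor-E : E * fromℕ (validTotal n) ≡ ∑ (suc n) (λ i → ∑ (suc n) (λ j → E * b i j))
    factor-E = trans (cong (E *_) (fromℕ-validTotal≡∑∑ n))
                     (trans (*-distribˡ-∑ (suc n) E (λ i → ∑ (suc n) (b i)))
                            (∑-cong (suc n) (λ i → *-distribˡ-∑ (suc n) E (b i))))
    rearrange : ∀ r f → (r + r) * f ≡ (f + f) * r
    rearrange = solve 2 (λ r f → (r :+ r) :* f := (f :+ f) :* r) refl

  archimedean : ∀ ε → 0ℚ < ε → Σ ℕ λ d → 1ℚ ≤ ε * fromℕ (suc d)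
  archimedean (mkℚ (ℤ.+ 0)     _ _) 0<ε = ⊥-elim (ℤ.Positive.pos (positive 0<ε))
  archimedean (mkℚ ℤ.-[1+ _ ]  _ _) 0<ε = ⊥-elim (ℤ.Positive.pos (positive 0<ε))
  archimedean ε@(mkℚ (ℤ.+ suc p) d _) _ = d , (begin
    1ℚ                  ≤⟨ fromℕ-mono-≤ (s≤s (z≤n {p})) ⟩
    fromℕ (suc p)       ≡⟨ ε*denominator≡numerator ⟨
    ε * fromℕ (suc d)   ∎)
    where
    open ℚ.≤-Reasoning
    cross : ∀ d p → (d ℕ.+ p ℕ.* suc d) ℕ.* 1 ≡ d ℕ.* 1 ℕ.+ p ℕ.* suc (d ℕ.* 1)
    cross = solve-∀
    ε*denominator≡numerator : ε * fromℕ (suc d) ≡ fromℕ (suc p)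
    ε*denominator≡numerator = trans (cong (ε *_) (fromℕ≡mkℚ/1 (suc d))) (trans
      (ℚ.toℚᵘ-injective (ℚᵘ.≃-trans (ℚ.toℚᵘ-homo-* ε (mkℚ/1 (suc d)))
                                     (ℚᵘ.*≡* (cong (λ x → ℤ.+ suc x) (cross d p)))))
      (sym (fromℕ≡mkℚ/1 (suc p))))

  weightTail-vanishes : ∀ n c ε → 0ℚ < ε → Σ ℕ λ N → fromℕ c * weightTail N n < ε
  weightTail-vanishes n c ε 0<ε = N , ℚ.*-cancelʳ-<-nonNeg D {{nonNegative (fromℕ-nonNeg (suc d))}} (begin-strict
    fromℕ c * (fromℕ Q * h) * D             ≡⟨ regroup (fromℕ c) (fromℕ Q) h D ⟩
    fromℕ c * D * fromℕ Q * h               ≡⟨ cong (λ x → x * fromℕ Q * h) (fromℕ-* c (suc d)) ⟨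
    fromℕ (c ℕ.* suc d) * fromℕ Q * h       ≡⟨ cong (_* h) (fromℕ-* (c ℕ.* suc d) Q) ⟨
    fromℕ (c ℕ.* suc d ℕ.* Q) * h           <⟨ ℚ.*-monoˡ-<-pos h {{positive (halfPow-pos N)}} (fromℕ-mono-< cDQ<2^N) ⟩
    fromℕ (2 ℕ.^ N) * h                     ≡⟨ 2^*halfPow N ⟩
    1ℚ                                      ≤⟨ proj₂ (archimedean ε 0<ε) ⟩
    ε * D                                   ∎)
    where
    open ℚ.≤-Reasoning
    d = proj₁ (archimedean ε 0<ε)
    D = fromℕ (suc d)
    N = proj₁ (binomialSum-small n (c ℕ.* suc d))
    cDQ<2^N = proj₂ (binomialSum-small n (c ℕ.* suc d))
    Q = binomialSum N n
    h = halfPow N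
    regroup : ∀ c q h d → c * (q * h) * d ≡ c * d * q * h
    regroup = solve 4 (λ c q h d → c :* (q :* h) :* d := c :* d :* q :* h) refl

  p<q+r⇒p-r<q : ∀ {p q r} → p < q + r → p - r < q
  p<q+r⇒p-r<q {p} {q} {r} p<q+r = subst (p - r <_) (cancel q r) (ℚ.+-monoˡ-< (- r) p<q+r)
    where
    cancel : ∀ q r → q + r - r ≡ q
    cancel = solve 2 (λ q r → q :+ r :- r := q) refl

open import Defs
open import Data.Nat as ℕ using (ℕ)
open import Data.Integer using (+_)
open import Data.Rational using (_/_; 0ℚ; _≤_; _<_; _-_)
open import Data.Product using (Σ; _×_; _,_; ∃; proj₁; proj₂)
open import Data.Fin using (Fin)
open import Function.Bundles using (_↔_)
import Data.Rational.Properties as ℚ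
open import Relation.Binary.PropositionalEquality using (subst; sym)
open Enumeration using (validTotal; Fin-validTotal↔Counted)
open Series using (+n/1≡fromℕ; partial≤validTotal; validTotal≤partial+tail; weightTail-vanishes; p<q+r⇒p-r<q)

proposition1 : (n : ℕ) → Σ ℕ λ F → (Fin F ↔ Counted n) × SumsTo (term n) ((+ F) / 1)
proposition1 n = validTotal n , Fin-validTotal↔Counted n , upper , lower
  where
  upper : ∀ N → partial n N ≤ (+ validTotal n) / 1
  upper N = subst (partial n N ≤_) (sym (+n/1≡fromℕ (validTotal n))) (partial≤validTotal n N)
  lower : ∀ ε → 0ℚ < ε → ∃ λ N → (+ validTotal n) / 1 - ε < partial n N
  lower ε 0<ε = N , subst (λ x → x - ε < partial n N) (sym (+n/1≡fromℕ (validTotal n)))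
    (p<q+r⇒p-r<q (ℚ.≤-<-trans (validTotal≤partial+tail n N) (ℚ.+-monoʳ-< (partial n N) tail<ε)))
    where
    N = proj₁ (weightTail-vanishes n (validTotal n ℕ.+ validTotal n) ε 0<ε)
    tail<ε = proj₂ (weightTail-vanishes n (validTotal n ℕ.+ validTotal n) ε 0<ε)
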